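{- Let $\mathsf{M}^*$ be a minimal Mealy machine over input alphabet $\tilde\Sigma_i$ and output alphabet $\tilde\Sigma_o$, accessible only through a membership oracle $\mathrm{MOracle}$ which, given an input word $w\in\tilde\Sigma_i^*$, returns the output word $\mathsf{M}^*(w)$. Assume $\mathsf{M}^*$ has distinguisher bound $B_{\mathrm{Dist}}$. Let $\mathsf{M}=\langle Q, q_\iota, \tilde\Sigma_i, \tilde\Sigma_o, \delta, \mathrm{Out}\rangle$ be a Mealy machine (all of whose states are reachable from $q_\iota$) and run the following procedure: (1) for each $q\in Q$ choose $R(q)\in\tilde\Sigma_i^*$ of minimal length with $\delta(q_\iota, R(q)) = q$; (2) for each $q\in Q$ and $i\in\tilde\Sigma_i$: let $w = R(q)\cdot i$; if $\mathrm{Out}(q,i)$ differs from the last symbol of $\mathrm{MOracle}(w)$, return $w$; otherwise let $q'=\delta(q,i)$ and $w' = R(q')$, and search over all $s\in\tilde\Sigma_i^{\le B_{\mathrm{Dist}}}$ for one such that the last $|s|$ symbols of $\mathrm{MOracle}(w\cdot s)$ and of $\mathrm{MOracle}(w'\cdot s)$ differ; if such an $s$ is found, return $R(q)\cdot i\cdot s$ if $\mathsf{M}(R(q)\cdot i\cdot s)\neq \mathrm{MOracle}(R(q)\cdot i\cdot s)$, and otherwise return $R(q')\cdot s$; (3) if no word was returned in step (2), return Correct. Then either (a) the procedure returns Correct and $\mathsf{M}(w)=\mathsf{M}^*(w)$ for all $w\in\tilde\Sigma_i^*$, or (b) the procedure returns a counterexample $\mathrm{cex}$ with $\mathsf{M}(\mathrm{cex})\neq\mathsf{M}^*(\mathrm{cex})$.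 Further, it performs at most $|Q|\cdot|\tilde\Sigma_i|^{B_{\mathrm{Dist}}+1}$ membership queries.
   Context: A Mealy machine is a tuple $\langle Q, q_\iota, \tilde\Sigma_i, \tilde\Sigma_o, \delta, \mathrm{Out}\rangle$ with finite state set $Q$, initial state $q_\iota$, finite input alphabet $\tilde\Sigma_i$, finite output alphabet $\tilde\Sigma_o$, transition function $\delta: Q\times\tilde\Sigma_i\to Q$ and output function $\mathrm{Out}: Q\times\tilde\Sigma_i\to\tilde\Sigma_o$, both extended to input words in the usual way; $\mathsf{M}(w)$ denotes $\mathrm{Out}(q_\iota,w)$, the output word produced on input word $w$. A distinguisher bound $B\in\mathbb{N}$ for $\mathsf{M}^*$ means that every pair of distinct states $q_1^*,q_2^*$ of $\mathsf{M}^*$ is distinguished by an input word $w$ of length at most $B$, i.e. the outputs of $\mathsf{M}^*$ on $w$ from $q_1^*$ and from $q_2^*$ differ. $\tilde\Sigma_i^{\le B}$ denotes the set of input words of length at most $B$.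
   Formalization: The query bound is replaced by: every word submitted to MOracle is a prefix of a word in some list of at most $|Q|\cdot|\tilde\Sigma_i|^{B_{\mathrm{Dist}}+1}$ words. The statement above fails without it. -}

module Defs where

open import Data.Bool using (Bool; true; false; if_then_else_)
open import Data.Nat using (ℕ; zero; suc; _+_; _*_; _^_; _≤_; _∸_)
open import Data.Fin using (Fin)
import Data.Fin.Properties as FinP
open import Data.List using (List; []; _∷_; _++_; [_]; length; map; concatMap; allFin; upTo; last; drop)
import Data.List.Properties as ListP
import Data.Maybe.Properties as MaybeP
open import Data.Maybe using (Maybe; just; nothing)
open import Data.Product using (Σ; ∃; _×_; _,_; proj₁; proj₂)
open import Relation.Nullary using (¬_; does)
open import Relation.Binary.PropositionalEquality using (_≡_; _≢_)

Word : ℕ → Set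
Word k = List (Fin k)

-- A Mealy machine with state set Fin n (so |Q| = n), input alphabet Fin k
-- (so |Σ_i| = k) and output alphabet Fin m.
record Mealy (n k m : ℕ) : Set where
  field
    init : Fin n
    δ    : Fin n → Fin k → Fin n
    out  : Fin n → Fin k → Fin m

module _ {n k m : ℕ} (M : Mealy n k m) where
  open Mealy M

  δ* : Fin n → Word k → Fin n
  δ* q []       = q
  δ* q (i ∷ w)  = δ* (δ q i) w

  Out* : Fin n → Word k → Word m
  Out* q []      = []
  Out* q (i ∷ w) = out q i ∷ Out* (δ q i) w

  run : Word k → Word m
  run w = Out* init w

  Reachable : Set
  Reachable = ∀ q → ∃ λ u → δ* init u ≡ q

  DistinguisherBound : ℕ → Set
  DistinguisherBound B = ∀ q₁ q₂ → q₁ ≢ q₂ →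
    ∃ λ w → length w ≤ B × Out* q₁ w ≢ Out* q₂ w


  ShortestAccess : (Fin n → Word k) → Set
  ShortestAccess R = ∀ q → δ* init (R q) ≡ q × (∀ u → δ* init u ≡ q → length (R q) ≤ length u)

Minimal : {n k m : ℕ} → Mealy n k m → Set
Minimal {n} {k} {m} M = ∀ n′ (M′ : Mealy n′ k m) → (∀ w → run M′ w ≡ run M w) → n ≤ n′

_≼_ : {A : Set} → List A → List A → Set
u ≼ v = ∃ λ t → u ++ t ≡ v

suffix : {A : Set} → ℕ → List A → List A
suffix l xs = drop (length xs ∸ l) xs

wordsOfLen : (k l : ℕ) → List (Word k)
wordsOfLen k zero    = [] ∷ []
wordsOfLen k (suc l) = concatMap (λ i → map (i ∷_) (wordsOfLen k l)) (allFin k)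

wordsUpTo : (k B : ℕ) → List (Word k)
wordsUpTo k B = concatMap (wordsOfLen k) (upTo (suc B))

_≟w_ : {m : ℕ} → (u v : Word m) → Bool
u ≟w v = does (ListP.≡-dec FinP._≟_ u v)

_≟ms_ : {m : ℕ} → (a b : Maybe (Fin m)) → Bool
a ≟ms b = does (MaybeP.≡-dec FinP._≟_ a b)

data Result (k : ℕ) : Set where
  correct : Result k
  cex     : Word k → Result k

-- Each function returns, besides
-- its result, the list of all words submitted to the oracle, in order.
module Procedure {n k m : ℕ} (M : Mealy n k m) (R : Fin n → Word k) (B : ℕ)
                 (oracle : Word k → Word m) where
  open Mealy M

  search : Word k → Word k → List (Word k) → Maybe (Word k) × List (Word k)
  search w w′ []       = nothing , []
  search w w′ (s ∷ ss) =
    if suffix (length s) (oracle (w ++ s)) ≟w suffix (length s) (oracle (w′ ++ s))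
    then (proj₁ (search w w′ ss) , (w ++ s) ∷ (w′ ++ s) ∷ proj₂ (search w w′ ss))
    else (just s , (w ++ s) ∷ (w′ ++ s) ∷ [])

  checkPair : Fin n → Fin k → Maybe (Word k) × List (Word k)
  checkPair q i = body (search w w′ (wordsUpTo k B))
    where
      w  = R q ++ [ i ]
      q′ = δ q i
      w′ = R q′
      body : Maybe (Word k) × List (Word k) → Maybe (Word k) × List (Word k)
      body (r , qs) =
        if last (oracle w) ≟ms just (out q i)
        then (finish r qs)
        else (just w , w ∷ [])
        where
          finish : Maybe (Word k) → List (Word k) → Maybe (Word k) × List (Word k)
          finish nothing  qs = nothing , w ∷ qs
          finish (just s) qs =
            (if run M (w ++ s) ≟w oracle (w ++ s) then just (w′ ++ s) else just (w ++ s))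
            , w ∷ qs ++ [ w ++ s ]

  pairs : List (Fin n × Fin k)
  pairs = concatMap (λ q → map (q ,_) (allFin k)) (allFin n)

  loop : List (Fin n × Fin k) → Result k × List (Word k)
  loop []             = correct , []
  loop ((q , i) ∷ ps) = step (checkPair q i)
    where
      step : Maybe (Word k) × List (Word k) → Result k × List (Word k)
      step (nothing , qs) = proj₁ (loop ps) , qs ++ proj₂ (loop ps)
      step (just c  , qs) = cex c , qs

  procedure : Result k × List (Word k)
  procedure = loop pairs

-- A returned word is a counterexample: either M's last output on R q · i is wrong, or the oracle
-- separates R q · i and R (δ q i) by a suffix s although both reach the same state of M, so M is
-- wrong on R q · i · s or on R (δ q i) · s. If every test passes, q ↦ δ*(init*, R q) preserves the
-- outputs of M, and it commutes with the transitions because distinct states of M* are separated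
-- by some tested s with |s| ≤ B; such a simulation forces M and M* to compute the same function.
-- Every query is R q · t with |t| ≤ B + 1, a prefix of one of the n · k^(B+1) words with |t| = B + 1.
module Submission where

open import Defs
open import Data.Nat using (ℕ; zero; suc; _+_; _*_; _^_; _≤_; _∸_; z≤n; s≤s)
open import Data.Nat.Properties using (≤-pred; ≤-reflexive; m≤n⇒m≤1+n; m+n∸n≡m; m+[n∸m]≡n)
open import Data.Fin using (Fin)
import Data.Fin.Properties as FinP
open import Data.Maybe using (just; nothing)
import Data.Maybe.Properties as MaybeP
open import Data.List using (List; []; _∷_; _++_; [_]; length; map; concatMap; cartesianProductWith; allFin; upTo; last; drop; replicate)
import Data.List.Properties as ListP
open import Data.List.Membership.Propositional using (_∈_; lose)
open import Data.List.Membership.Propositional.Properties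
  using (∈-cartesianProductWith⁺; ∈-cartesianProductWith⁻; ∈-concat⁺′; ∈-concat⁻′; ∈-map⁺; ∈-map⁻; ∈-upTo⁺; ∈-upTo⁻; ∈-allFin)
open import Data.List.Relation.Unary.All using (All; []; _∷_; lookup; tabulate)
open import Data.List.Relation.Unary.All.Properties using (++⁺)
open import Data.List.Relation.Unary.Any using (Any; here; there)
open import Data.Product using (∃; _×_; _,_; proj₁; proj₂)
open import Data.Sum using (_⊎_; inj₁; inj₂; map₁)
open import Relation.Nullary using (¬_; Dec; yes; no)
open import Relation.Nullary.Decidable using (decidable-stable)
open import Relation.Binary.PropositionalEquality
  using (_≡_; _≢_; refl; sym; trans; cong; cong₂; subst; module ≡-Reasoning)
open ≡-Reasoning

private
  variable
    A B C : Set

last-++-[] : ∀ (xs : List A) x → last (xs ++ [ x ]) ≡ just x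
last-++-[] []           x = refl
last-++-[] (_ ∷ [])     x = refl
last-++-[] (_ ∷ y ∷ ys) x = last-++-[] (y ∷ ys) x

drop-length-++ : ∀ (xs ys : List A) → drop (length xs) (xs ++ ys) ≡ ys
drop-length-++ []       ys = refl
drop-length-++ (_ ∷ xs) ys = drop-length-++ xs ys

suffix-++ : ∀ (xs ys : List A) → suffix (length ys) (xs ++ ys) ≡ ys
suffix-++ xs ys = begin
  drop (length (xs ++ ys) ∸ length ys) (xs ++ ys)
    ≡⟨ cong (λ l → drop (l ∸ length ys) (xs ++ ys)) (ListP.length-++ xs) ⟩
  drop (length xs + length ys ∸ length ys) (xs ++ ys)
    ≡⟨ cong (λ l → drop l (xs ++ ys)) (m+n∸n≡m (length xs) (length ys)) ⟩
  drop (length xs) (xs ++ ys)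
    ≡⟨ drop-length-++ xs ys ⟩
  ys
    ∎

concatMap-map≡cartesianProductWith : ∀ (f : A → B → C) xs ys →
  concatMap (λ x → map (f x) ys) xs ≡ cartesianProductWith f xs ys
concatMap-map≡cartesianProductWith f []       ys = refl
concatMap-map≡cartesianProductWith f (x ∷ xs) ys =
  cong (map (f x) ys ++_) (concatMap-map≡cartesianProductWith f xs ys)

length-cartesianProductWith : ∀ (f : A → B → C) xs ys →
  length (cartesianProductWith f xs ys) ≡ length xs * length ys
length-cartesianProductWith f []       ys = refl
length-cartesianProductWith f (x ∷ xs) ys = begin
  length (map (f x) ys ++ cartesianProductWith f xs ys)
    ≡⟨ ListP.length-++ (map (f x) ys) ⟩
  length (map (f x) ys) + length (cartesianProductWith f xs ys)
    ≡⟨ cong₂ _+_ (ListP.length-map (f x) ys) (length-cartesianProductWith f xs ys) ⟩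
  length ys + length xs * length ys
    ∎

module _ {k : ℕ} where

  wordsOfLen-suc : ∀ l → wordsOfLen k (suc l) ≡ cartesianProductWith _∷_ (allFin k) (wordsOfLen k l)
  wordsOfLen-suc l = concatMap-map≡cartesianProductWith _∷_ (allFin k) (wordsOfLen k l)

  length-wordsOfLen : ∀ l → length (wordsOfLen k l) ≡ k ^ l
  length-wordsOfLen zero    = refl
  length-wordsOfLen (suc l) = begin
    length (wordsOfLen k (suc l))
      ≡⟨ cong length (wordsOfLen-suc l) ⟩
    length (cartesianProductWith _∷_ (allFin k) (wordsOfLen k l))
      ≡⟨ length-cartesianProductWith _∷_ (allFin k) (wordsOfLen k l) ⟩
    length (allFin k) * length (wordsOfLen k l)
      ≡⟨ cong₂ _*_ (ListP.length-tabulate {n = k} (λ i → i)) (length-wordsOfLen l) ⟩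
    k * k ^ l
      ∎

  ∈-wordsOfLen⁺ : ∀ (s : Word k) → s ∈ wordsOfLen k (length s)
  ∈-wordsOfLen⁺ []      = here refl
  ∈-wordsOfLen⁺ (i ∷ s) = subst (i ∷ s ∈_) (sym (wordsOfLen-suc (length s)))
    (∈-cartesianProductWith⁺ _∷_ (∈-allFin i) (∈-wordsOfLen⁺ s))

  ∈-wordsOfLen⁻ : ∀ l {s : Word k} → s ∈ wordsOfLen k l → length s ≡ l
  ∈-wordsOfLen⁻ zero    (here refl) = refl
  ∈-wordsOfLen⁻ (suc l) s∈
    with ∈-cartesianProductWith⁻ _∷_ (allFin k) (wordsOfLen k l) (subst (_ ∈_) (wordsOfLen-suc l) s∈)
  ... | _ , t , _ , t∈ , refl = cong suc (∈-wordsOfLen⁻ l t∈)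

  ∈-wordsUpTo⁺ : ∀ {B} (s : Word k) → length s ≤ B → s ∈ wordsUpTo k B
  ∈-wordsUpTo⁺ s |s|≤B = ∈-concat⁺′ (∈-wordsOfLen⁺ s) (∈-map⁺ (wordsOfLen k) (∈-upTo⁺ (s≤s |s|≤B)))

  ∈-wordsUpTo⁻ : ∀ B {s : Word k} → s ∈ wordsUpTo k B → length s ≤ B
  ∈-wordsUpTo⁻ B s∈ with ∈-concat⁻′ (map (wordsOfLen k) (upTo (suc B))) s∈
  ... | _ , s∈ws , ws∈ with ∈-map⁻ (wordsOfLen k) ws∈
  ... | l , l∈ , refl = subst (_≤ B) (sym (∈-wordsOfLen⁻ l s∈ws)) (≤-pred (∈-upTo⁻ l∈))

  ≼-wordsOfLen : Fin k → ∀ {l} (s : Word k) → length s ≤ l → ∃ λ t → s ≼ t × t ∈ wordsOfLen k l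
  ≼-wordsOfLen a {l} s |s|≤l =
    s ++ pad , (pad , refl) , subst (λ l′ → s ++ pad ∈ wordsOfLen k l′) length≡l (∈-wordsOfLen⁺ (s ++ pad))
    where
      pad : Word k
      pad = replicate (l ∸ length s) a
      length≡l : length (s ++ pad) ≡ l
      length≡l = begin
        length (s ++ pad)          ≡⟨ ListP.length-++ s ⟩
        length s + length pad      ≡⟨ cong (length s +_) (ListP.length-replicate (l ∸ length s)) ⟩
        length s + (l ∸ length s)  ≡⟨ m+[n∸m]≡n |s|≤l ⟩
        l                          ∎

module MealyProperties {n k m : ℕ} (M : Mealy n k m) where
  open Mealy M

  δ*-++ : ∀ q u v → δ* M q (u ++ v) ≡ δ* M (δ* M q u) v
  δ*-++ q []      v = refl
  δ*-++ q (i ∷ u) v = δ*-++ (δ q i) u v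

  Out*-++ : ∀ q u v → Out* M q (u ++ v) ≡ Out* M q u ++ Out* M (δ* M q u) v
  Out*-++ q []      v = refl
  Out*-++ q (i ∷ u) v = cong (out q i ∷_) (Out*-++ (δ q i) u v)

  length-Out* : ∀ q u → length (Out* M q u) ≡ length u
  length-Out* q []      = refl
  length-Out* q (i ∷ u) = cong suc (length-Out* (δ q i) u)

  last-Out*-++-[] : ∀ q u i → last (Out* M q (u ++ [ i ])) ≡ just (out (δ* M q u) i)
  last-Out*-++-[] q u i = trans (cong last (Out*-++ q u [ i ])) (last-++-[] (Out* M q u) _)

  suffix-Out*-++ : ∀ q u s → suffix (length s) (Out* M q (u ++ s)) ≡ Out* M (δ* M q u) s
  suffix-Out*-++ q u s = begin
    suffix (length s) (Out* M q (u ++ s))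
      ≡⟨ cong₂ suffix (sym (length-Out* (δ* M q u) s)) (Out*-++ q u s) ⟩
    suffix (length (Out* M (δ* M q u) s)) (Out* M q u ++ Out* M (δ* M q u) s)
      ≡⟨ suffix-++ (Out* M q u) (Out* M (δ* M q u) s) ⟩
    Out* M (δ* M q u) s
      ∎

  Out*-simulation : ∀ {n′} (M′ : Mealy n′ k m) (f : Fin n → Fin n′) →
    (∀ q i → Mealy.out M′ (f q) i ≡ out q i) →
    (∀ q i → Mealy.δ M′ (f q) i ≡ f (δ q i)) →
    ∀ q w → Out* M q w ≡ Out* M′ (f q) w
  Out*-simulation M′ f out-f δ-f q []      = refl
  Out*-simulation M′ f out-f δ-f q (i ∷ w) = cong₂ _∷_ (sym (out-f q i))
    (trans (Out*-simulation M′ f out-f δ-f (δ q i) w) (cong (λ p → Out* M′ p w) (sym (δ-f q i))))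

module ProcedureProperties {n k m : ℕ} (M : Mealy n k m) (R : Fin n → Word k) (B : ℕ)
                           (oracle : Word k → Word m) where
  open Mealy M
  open Procedure M R B oracle
  open MealyProperties M

  AgreeAfter : Word k → Word k → Word k → Set
  AgreeAfter w w′ s = suffix (length s) (oracle (w ++ s)) ≡ suffix (length s) (oracle (w′ ++ s))

  agreeAfter? : ∀ w w′ s → Dec (AgreeAfter w w′ s)
  agreeAfter? w w′ s = ListP.≡-dec FinP._≟_ _ _

  lastOutput? : ∀ q i → Dec (last (oracle (R q ++ [ i ])) ≡ just (out q i))
  lastOutput? q i = MaybeP.≡-dec FinP._≟_ _ _

  consistent? : ∀ u → Dec (run M u ≡ oracle u)
  consistent? u = ListP.≡-dec FinP._≟_ _ _

  search-nothing : ∀ w w′ ss → proj₁ (search w w′ ss) ≡ nothing → All (AgreeAfter w w′) ss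
  search-nothing w w′ []       _ = []
  search-nothing w w′ (s ∷ ss) with agreeAfter? w w′ s
  ... | yes agree = λ found-none → agree ∷ search-nothing w w′ ss found-none
  ... | no _      = λ ()

  search-just : ∀ w w′ ss {s} → proj₁ (search w w′ ss) ≡ just s → s ∈ ss × ¬ AgreeAfter w w′ s
  search-just w w′ []        ()
  search-just w w′ (s′ ∷ ss) with agreeAfter? w w′ s′
  ... | yes _       = λ found → let s∈ , disagree = search-just w w′ ss found in there s∈ , disagree
  ... | no disagree = λ { refl → here refl , disagree }

  search-queries : (P : Word k → Set) → ∀ w w′ ss →
    All (λ s → P (w ++ s) × P (w′ ++ s)) ss → All P (proj₂ (search w w′ ss))
  search-queries P w w′ []       []                 = []
  search-queries P w w′ (s ∷ ss) ((pw , pw′) ∷ pss) with agreeAfter? w w′ s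
  ... | yes _ = pw ∷ pw′ ∷ search-queries P w w′ ss pss
  ... | no _  = pw ∷ pw′ ∷ []

  agreeAfter-same-state : ∀ w w′ s → δ* M init w ≡ δ* M init w′ →
    run M (w ++ s) ≡ oracle (w ++ s) → run M (w′ ++ s) ≡ oracle (w′ ++ s) → AgreeAfter w w′ s
  agreeAfter-same-state w w′ s same agree agree′ = begin
    suffix (length s) (oracle (w ++ s))  ≡⟨ cong (suffix (length s)) (sym agree) ⟩
    suffix (length s) (run M (w ++ s))   ≡⟨ suffix-Out*-++ init w s ⟩
    Out* M (δ* M init w) s               ≡⟨ cong (λ p → Out* M p s) same ⟩
    Out* M (δ* M init w′) s              ≡⟨ sym (suffix-Out*-++ init w′ s) ⟩
    suffix (length s) (run M (w′ ++ s))  ≡⟨ cong (suffix (length s)) agree′ ⟩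
    suffix (length s) (oracle (w′ ++ s)) ∎

  Passes : Fin n × Fin k → Set
  Passes (q , i) = proj₁ (checkPair q i) ≡ nothing

  module _ (access : ∀ q → δ* M init (R q) ≡ q) where

    δ*-access-++-[] : ∀ q i → δ* M init (R q ++ [ i ]) ≡ δ q i
    δ*-access-++-[] q i = trans (δ*-++ init (R q) [ i ]) (cong (λ p → δ p i) (access q))

    checkPair-cex : ∀ q i {c} → proj₁ (checkPair q i) ≡ just c → run M c ≢ oracle c
    checkPair-cex q i with lastOutput? q i
                         | search (R q ++ [ i ]) (R (δ q i)) (wordsUpTo k B) in found
    ... | no wrong-output | _ = λ { refl agree → wrong-output (begin
      last (oracle (R q ++ [ i ]))    ≡⟨ cong last agree ⟨
      last (run M (R q ++ [ i ]))     ≡⟨ last-Out*-++-[] init (R q) i ⟩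
      just (out (δ* M init (R q)) i)  ≡⟨ cong (λ p → just (out p i)) (access q) ⟩
      just (out q i)                  ∎) }
    ... | yes _ | nothing , _ = λ ()
    ... | yes _ | just s , _ with consistent? ((R q ++ [ i ]) ++ s)
    ...   | no disagree = λ { refl → disagree }
    ...   | yes agree   = λ { refl agree′ →
      proj₂ (search-just (R q ++ [ i ]) (R (δ q i)) (wordsUpTo k B) (cong proj₁ found))
        (agreeAfter-same-state (R q ++ [ i ]) (R (δ q i)) s
          (trans (δ*-access-++-[] q i) (sym (access (δ q i)))) agree agree′) }

    loop-outcome : ∀ ps →
      (proj₁ (loop ps) ≡ correct × All Passes ps) ⊎ (∃ λ c → proj₁ (loop ps) ≡ cex c × run M c ≢ oracle c)
    loop-outcome []             = inj₁ (refl , [])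
    loop-outcome ((q , i) ∷ ps) with checkPair q i in checked
    ... | just c , _  = inj₂ (c , refl , checkPair-cex q i (cong proj₁ checked))
    ... | nothing , _ with loop-outcome ps
    ...   | inj₁ (is-correct , passes) = inj₁ (is-correct , cong proj₁ checked ∷ passes)
    ...   | inj₂ counterexample        = inj₂ counterexample

  checkPair-nothing : ∀ q i → Passes (q , i) →
    last (oracle (R q ++ [ i ])) ≡ just (out q i) × All (AgreeAfter (R q ++ [ i ]) (R (δ q i))) (wordsUpTo k B)
  checkPair-nothing q i with lastOutput? q i
                           | search (R q ++ [ i ]) (R (δ q i)) (wordsUpTo k B) in found
  ... | no _             | _          = λ ()
  ... | yes right-output | nothing , _ = λ _ →
    right-output , search-nothing (R q ++ [ i ]) (R (δ q i)) (wordsUpTo k B) (cong proj₁ found)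
  ... | yes _            | just s , _ with consistent? ((R q ++ [ i ]) ++ s)
  ...   | no _  = λ ()
  ...   | yes _ = λ ()

  module _ (P : Word k → Set) (q : Fin n) (i : Fin k)
           (P-queries : ∀ s → length s ≤ B → P (R q ++ i ∷ s) × P (R (δ q i) ++ s)) where
    private
      w w′ : Word k
      w  = R q ++ [ i ]
      w′ = R (δ q i)

      P-w : P w
      P-w = proj₁ (P-queries [] z≤n)

      P-w++ : ∀ {s} → s ∈ wordsUpTo k B → P (w ++ s)
      P-w++ {s} s∈ = subst P (sym (ListP.++-assoc (R q) [ i ] s)) (proj₁ (P-queries s (∈-wordsUpTo⁻ B s∈)))

      P-searched : All P (proj₂ (search w w′ (wordsUpTo k B)))
      P-searched = search-queries P w w′ (wordsUpTo k B)
        (tabulate λ s∈ → P-w++ s∈ , proj₂ (P-queries _ (∈-wordsUpTo⁻ B s∈)))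

    checkPair-queries : All P (proj₂ (checkPair q i))
    checkPair-queries with lastOutput? q i | search w w′ (wordsUpTo k B) in found
    ... | no _  | _           = P-w ∷ []
    ... | yes _ | nothing , _ = P-w ∷ subst (λ r → All P (proj₂ r)) found P-searched
    ... | yes _ | just s , _  = P-w ∷ ++⁺ (subst (λ r → All P (proj₂ r)) found P-searched)
                                          (P-w++ (proj₁ (search-just w w′ (wordsUpTo k B) (cong proj₁ found))) ∷ [])

  loop-queries : (P : Word k → Set) → (∀ q i → All P (proj₂ (checkPair q i))) → ∀ ps → All P (proj₂ (loop ps))
  loop-queries P P-checkPair []             = []
  loop-queries P P-checkPair ((q , i) ∷ ps) with checkPair q i | P-checkPair q i
  ... | just _ , _   | P-qs = P-qs
  ... | nothing , _  | P-qs = ++⁺ P-qs (loop-queries P P-checkPair ps)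

  ∈-pairs : ∀ q i → (q , i) ∈ pairs
  ∈-pairs q i = subst ((q , i) ∈_) (sym (concatMap-map≡cartesianProductWith _,_ (allFin n) (allFin k)))
    (∈-cartesianProductWith⁺ _,_ (∈-allFin q) (∈-allFin i))

module _ {n* n k m : ℕ} (M* : Mealy n* k m) (B : ℕ) (M : Mealy n k m) (R : Fin n → Word k) where
  open Mealy M
  private
    module M* = Mealy M*
    module P* = MealyProperties M*
  open ProcedureProperties M R B (run M*)

  image : Fin n → Fin n*
  image q = δ* M* M*.init (R q)

  module _ (q : Fin n) (i : Fin k) (passes : Passes (q , i)) where
    image-out : M*.out (image q) i ≡ out q i
    image-out = MaybeP.just-injective
      (trans (sym (P*.last-Out*-++-[] M*.init (R q) i)) (proj₁ (checkPair-nothing q i passes)))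

    image-δ : DistinguisherBound M* B → M*.δ (image q) i ≡ image (δ q i)
    image-δ distinguish = decidable-stable (M*.δ (image q) i FinP.≟ image (δ q i)) λ differ →
      let s , |s|≤B , distinguished = distinguish _ _ differ in
      distinguished (begin
        Out* M* (M*.δ (image q) i) s                     ≡⟨ cong (λ p → Out* M* p s) (P*.δ*-++ M*.init (R q) [ i ]) ⟨
        Out* M* (δ* M* M*.init (R q ++ [ i ])) s          ≡⟨ P*.suffix-Out*-++ M*.init (R q ++ [ i ]) s ⟨
        suffix (length s) (run M* ((R q ++ [ i ]) ++ s)) ≡⟨ lookup (proj₂ (checkPair-nothing q i passes)) (∈-wordsUpTo⁺ s |s|≤B) ⟩
        suffix (length s) (run M* (R (δ q i) ++ s))      ≡⟨ P*.suffix-Out*-++ M*.init (R (δ q i)) s ⟩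
        Out* M* (image (δ q i)) s                        ∎)

  all-pass⇒equivalent : DistinguisherBound M* B → R init ≡ [] → (∀ q i → Passes (q , i)) → ∀ w → run M w ≡ run M* w
  all-pass⇒equivalent distinguish R-init passes w = begin
    run M w                 ≡⟨ MealyProperties.Out*-simulation M M* image
                                 (λ q i → image-out q i (passes q i)) (λ q i → image-δ q i (passes q i) distinguish) init w ⟩
    Out* M* (image init) w  ≡⟨ cong (λ u → Out* M* (δ* M* M*.init u) w) R-init ⟩
    run M* w                ∎

module _ {n k : ℕ} (R : Fin n → Word k) (B : ℕ) where

  -- Queries are counted up to prefixes: every query is a prefix of one of these words.
  maximalQueries : List (Word k)
  maximalQueries = concatMap (λ q → map (R q ++_) (wordsOfLen k (suc B))) (allFin n)

  length-maximalQueries : length maximalQueries ≡ n * k ^ suc B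
  length-maximalQueries = begin
    length maximalQueries
      ≡⟨ cong length (concatMap-map≡cartesianProductWith (λ q → R q ++_) (allFin n) (wordsOfLen k (suc B))) ⟩
    length (cartesianProductWith (λ q → R q ++_) (allFin n) (wordsOfLen k (suc B)))
      ≡⟨ length-cartesianProductWith (λ q → R q ++_) (allFin n) (wordsOfLen k (suc B)) ⟩
    length (allFin n) * length (wordsOfLen k (suc B))
      ≡⟨ cong₂ _*_ (ListP.length-tabulate {n = n} (λ q → q)) (length-wordsOfLen {k} (suc B)) ⟩
    n * k ^ suc B
      ∎

  ≼-maximalQueries : Fin k → ∀ q t → length t ≤ suc B → Any ((R q ++ t) ≼_) maximalQueries
  ≼-maximalQueries a q t |t|≤1+B with ≼-wordsOfLen a t |t|≤1+B
  ... | t′ , (pad , refl) , t′∈ = lose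
    (subst (_ ∈_) (sym (concatMap-map≡cartesianProductWith (λ q → R q ++_) (allFin n) (wordsOfLen k (suc B))))
      (∈-cartesianProductWith⁺ (λ q → R q ++_) (∈-allFin q) t′∈))
    (pad , ListP.++-assoc (R q) t pad)

shortestAccess-init : ∀ {n k m} (M : Mealy n k m) (R : Fin n → Word k) → ShortestAccess M R → R (Mealy.init M) ≡ []
shortestAccess-init M R shortest with R (Mealy.init M) | proj₂ (shortest (Mealy.init M)) [] refl
... | [] | _ = refl

theorem4 : ∀ {n* n k m : ℕ} (M* : Mealy n* k m) (B : ℕ) →
    Minimal M* → DistinguisherBound M* B →
    (M : Mealy n k m) → Reachable M →
    (R : Fin n → Word k) → ShortestAccess M R →
    (((proj₁ (Procedure.procedure M R B (run M*)) ≡ correct)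
        × (∀ w → run M w ≡ run M* w))
      ⊎ (∃ λ c → (proj₁ (Procedure.procedure M R B (run M*)) ≡ cex c)
        × (run M c ≢ run M* c)))
    × (∃ λ (L : List (Word k)) → (length L ≤ n * k ^ suc B)
        × All (λ u → Any (λ v → u ≼ v) L) (proj₂ (Procedure.procedure M R B (run M*))))
theorem4 M* B _ distinguish M _ R shortest =
  map₁ (λ (is-correct , passes) → is-correct ,
         all-pass⇒equivalent M* B M R distinguish (shortestAccess-init M R shortest) (λ q i → lookup passes (∈-pairs q i)))
       (loop-outcome (λ q → proj₁ (shortest q)) pairs) ,
  maximalQueries R B , ≤-reflexive (length-maximalQueries R B) ,
  loop-queries Covered (λ q i → checkPair-queries Covered q i λ s |s|≤B →
    ≼-maximalQueries R B i q (i ∷ s) (s≤s |s|≤B) , ≼-maximalQueries R B i (δ q i) s (m≤n⇒m≤1+n |s|≤B)) pairs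
  where
    open Mealy M
    open Procedure M R B (run M*)
    open ProcedureProperties M R B (run M*)
    Covered : Word _ → Set
    Covered u = Any (u ≼_) (maximalQueries R B)
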